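{- Let $G=(V,E)$ be a finite graph and $\psi$ a weak linear order of $V$, and run the procedure CO-Lex-BFS$(G,\psi)$ described in the context. (i) If the procedure terminates successfully, the returned order $V_1,\dots,V_c$ of the connected components of $G$ satisfies $V_1\le_\psi\dots\le_\psi V_c$. (ii) If the procedure stops (reports failure), then there is no ordering of the connected components of $G$ compatible with $\psi$, i.e. no ordering $W_1,\dots,W_c$ of the components with $W_1\le_\psi\dots\le_\psi W_c$.
   Context: A weak linear order $\psi=(B_1,\dots,B_p)$ on $V$ is an ordered partition; $x<_\psi y$ if $x\in B_i,y\in B_j$, $i<j$; for disjoint $U,W$, $U\le_\psi W$ means $x\le_\psi y$ for all $x\in U,y\in W$. Procedure CO-Lex-BFS$(G,\psi)$: it performs a lexicographic breadth-first search. Each vertex carries a label (a sequence of integers, initially empty); a start vertex $u\in B_1$ gets label $(|V|)$. For $i=|V|,|V|-1,\dots,1$: among unvisited vertices with lexicographically largest label, pick one coming first in $\psi$ (arbitrarily within a block), call it $p$, mark it visited, give it position $|V|-i+1$ in a vertex order $\sigma$, and append $i-1$ to the label of every unvisited neighbor of $p$. Vertices are grouped into components $V_1,V_2,\dots$ in the order discovered: when the picked vertex has empty label, a new component is opened (the start vertex opens $V_1$), otherwise $p$ joins the current component. For the current component $V_\omega$ let $B^{\min}_\omega$, $B^{\max}_\omega$ be the first and last blocks of $\psi$ meeting $V_\omega$. Whenever a component $V_\omega$ is completed (i.e. when a new component is about to be opened, and also after the last vertex is visited), the following checks are done: if some block $B$ of $\psi$ with $B^{\min}_\omega<_\psi B<_\psi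 B^{\max}_\omega$ satisfies $B\not\subseteq V_\omega$, stop (failure); if $\omega\ge 2$: if $V_\omega\subseteq B^{\min}_{\omega-1}$, swap $V_\omega$ and $V_{\omega-1}$ in the component order (updating $\sigma$ accordingly); otherwise, if $B^{\min}_\omega<_\psi B^{\max}_{\omega-1}$, stop (failure). If no failure occurs, it returns the final order $(V_1,\dots,V_c)$ of the components and $\sigma$. -}

module Defs where

open import Data.Nat using (ℕ; zero; suc; _≤_; _<_; _∸_; _⊓_; _⊔_)
open import Data.Bool using (Bool; true; false)
open import Data.Fin using (Fin; toℕ; _≟_)
open import Data.List using (List; []; _∷_; _++_; [_]; reverse; map)
open import Data.List.NonEmpty using (List⁺; _∷_; toList; foldr₁)
import Data.List.NonEmpty as L⁺
open import Data.List.Membership.Propositional using (_∈_; _∉_)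
open import Data.List.Relation.Unary.All using (All)
open import Data.List.Relation.Unary.Any using (Any)
open import Data.List.Relation.Unary.AllPairs using (AllPairs)
open import Data.List.Relation.Unary.Linked using (Linked)
open import Data.List.Relation.Binary.Lex.Strict using (Lex-<)
open import Data.Product using (Σ; ∃; _×_; _,_)
open import Relation.Binary.PropositionalEquality using (_≡_)
open import Relation.Nullary using (¬_; yes; no)

record Graph (n : ℕ) : Set where
  field
    Adj    : Fin n → Fin n → Bool
    sym    : ∀ x y → Adj x y ≡ Adj y x
    irrefl : ∀ x → Adj x x ≡ false
open Graph public

data Reach {n} (G : Graph n) : Fin n → Fin n → Set where
  here : ∀ {x} → Reach G x x
  step : ∀ {x y z} → Adj G x y ≡ true → Reach G y z → Reach G x z

IsComponent : ∀ {n} → Graph n → List (Fin n) → Set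
IsComponent G W =
  (∃ λ x → x ∈ W) ×
  (∀ x y → x ∈ W → y ∈ W → Reach G x y) ×
  (∀ x y → x ∈ W → Reach G x y → y ∈ W)

Disjoint : ∀ {n} → List (Fin n) → List (Fin n) → Set
Disjoint W W' = ∀ x → x ∈ W → x ∉ W'

IsComponentOrdering : ∀ {n} → Graph n → List (List (Fin n)) → Set
IsComponentOrdering G Ws =
  All (IsComponent G) Ws × (∀ v → Any (v ∈_) Ws) × AllPairs Disjoint Ws

-- Weak linear orders = ordered partitions (B_1,...,B_p) of Fin n.
-- block x = i means x ∈ B_(i+1); surjectivity = all blocks nonempty.

record WeakOrder (n : ℕ) : Set where
  field
    p     : ℕ
    block : Fin n → Fin p
    surj  : ∀ b → ∃ λ x → block x ≡ b
open WeakOrder public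

rk : ∀ {n} → WeakOrder n → Fin n → ℕ
rk ψ x = toℕ (block ψ x)

_⊑[_]_ : ∀ {n} → List (Fin n) → WeakOrder n → List (Fin n) → Set
U ⊑[ ψ ] W = ∀ x y → x ∈ U → y ∈ W → rk ψ x ≤ rk ψ y

SortedBy : ∀ {n} → WeakOrder n → List (List (Fin n)) → Set
SortedBy ψ = Linked (λ U W → U ⊑[ ψ ] W)

bmin bmax : ∀ {n} → WeakOrder n → List⁺ (Fin n) → ℕ
bmin ψ C = foldr₁ _⊓_ (L⁺.map (rk ψ) C)
bmax ψ C = foldr₁ _⊔_ (L⁺.map (rk ψ) C)

_<lex_ : List ℕ → List ℕ → Set
_<lex_ = Lex-< _≡_ _<_

GapFail : ∀ {n} → WeakOrder n → List⁺ (Fin n) → Set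
GapFail ψ C = Σ (Fin (p ψ)) λ b →
  (bmin ψ C < toℕ b) × (toℕ b < bmax ψ C) ×
  (∃ λ z → block ψ z ≡ b × z ∉ toList C)

⊆Bmin : ∀ {n} → WeakOrder n → List⁺ (Fin n) → List⁺ (Fin n) → Set
⊆Bmin ψ C L = ∀ x → x ∈ toList C → rk ψ x ≡ bmin ψ L

data CheckResult (n : ℕ) : Set where
  fail : CheckResult n
  ok   : List (List⁺ (Fin n)) → CheckResult n

-- Completion of component C.  The completed components are stored in
-- REVERSE order: the head of the list is the most recent V_(ω-1).
data Complete {n} (ψ : WeakOrder n) :
       List (List⁺ (Fin n)) → List⁺ (Fin n) → CheckResult n → Set where
  gap    : ∀ {D C} → GapFail ψ C → Complete ψ D C fail
  first  : ∀ {C} → ¬ GapFail ψ C → Complete ψ [] C (ok (C ∷ []))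
  swap   : ∀ {L R C} → ¬ GapFail ψ C → ⊆Bmin ψ C L →
           Complete ψ (L ∷ R) C (ok (L ∷ C ∷ R))
  clash  : ∀ {L R C} → ¬ GapFail ψ C → ¬ ⊆Bmin ψ C L →
           bmin ψ C < bmax ψ L → Complete ψ (L ∷ R) C fail
  append : ∀ {L R C} → ¬ GapFail ψ C → ¬ ⊆Bmin ψ C L →
           ¬ (bmin ψ C < bmax ψ L) → Complete ψ (L ∷ R) C (ok (C ∷ L ∷ R))

record State (n : ℕ) : Set where
  constructor st
  field
    i       : ℕ                    -- current value of the loop counter
    label   : Fin n → List ℕ
    visited : Fin n → Bool
    rdone   : List (List⁺ (Fin n)) -- completed components, reversed
    cur     : List (Fin n)         -- current component V_ω (empty before start)
open State public

initState : ∀ {n} → Fin n → State n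
initState {n} u = st n (λ v → lbl v) (λ _ → false) [] []
  where
    lbl : Fin n → List ℕ
    lbl v with v ≟ u
    ... | yes _ = n ∷ []
    ... | no  _ = []

Pickable : ∀ {n} → WeakOrder n → State n → Fin n → Set
Pickable ψ s p =
  visited s p ≡ false ×
  (∀ q → visited s q ≡ false → ¬ (label s p <lex label s q)) ×
  (∀ q → visited s q ≡ false → label s q ≡ label s p → rk ψ p ≤ rk ψ q)

visitLabels : ∀ {n} → Graph n → State n → Fin n → Fin n → List ℕ
visitLabels G s p q with visited s q | Adj G p q
... | false | true = label s q ++ [ i s ∸ 1 ]
... | _     | _    = label s q

visitMark : ∀ {n} → State n → Fin n → Fin n → Bool
visitMark s p q with q ≟ p
... | yes _ = true
... | no  _ = visited s q

data Outcome (n : ℕ) : Set where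
  success : List (List⁺ (Fin n)) → Outcome n
  failure : Outcome n

-- Run G ψ s o : from state s, some execution of the procedure
-- (arbitrary choices within blocks) ends with outcome o
data Run {n} (G : Graph n) (ψ : WeakOrder n) : State n → Outcome n → Set where
  finishOk   : ∀ {s c cs D} → (∀ x → visited s x ≡ true) → cur s ≡ c ∷ cs →
               Complete ψ (rdone s) (c ∷ cs) (ok D) →
               Run G ψ s (success (reverse D))
  finishFail : ∀ {s c cs} → (∀ x → visited s x ≡ true) → cur s ≡ c ∷ cs →
               Complete ψ (rdone s) (c ∷ cs) fail → Run G ψ s failure
  start      : ∀ {s p o} → Pickable ψ s p → cur s ≡ [] →
               Run G ψ (st (i s ∸ 1) (visitLabels G s p) (visitMark s p)
                           (rdone s) (p ∷ [])) o →
               Run G ψ s o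
  join       : ∀ {s p o c cs l ls} → Pickable ψ s p → cur s ≡ c ∷ cs →
               label s p ≡ l ∷ ls →
               Run G ψ (st (i s ∸ 1) (visitLabels G s p) (visitMark s p)
                           (rdone s) (cur s ++ p ∷ [])) o →
               Run G ψ s o
  openFail   : ∀ {s p c cs} → Pickable ψ s p → cur s ≡ c ∷ cs →
               label s p ≡ [] →
               Complete ψ (rdone s) (c ∷ cs) fail → Run G ψ s failure
  openOk     : ∀ {s p o c cs D} → Pickable ψ s p → cur s ≡ c ∷ cs →
               label s p ≡ [] →
               Complete ψ (rdone s) (c ∷ cs) (ok D) →
               Run G ψ (st (i s ∸ 1) (visitLabels G s p) (visitMark s p)
                           D (p ∷ [])) o →
               Run G ψ s o

componentsList : ∀ {n} → List (List⁺ (Fin n)) → List (List (Fin n))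
componentsList = map toList

{-# OPTIONS --safe #-}
-- Apart from the start vertex before the first visit, the labelled unvisited vertices are
-- exactly the unvisited neighbours of the current component V_ω.  Hence when the picked
-- vertex has an empty label, V_ω is a connected component of G; and since its first vertex
-- was ψ-minimal among the unvisited vertices, B^min_ω lies below every vertex visited later.
-- (i) Appending when B^max_(ω-1) ≤ B^min_ω, and swapping when V_ω ⊆ B^min_(ω-1), keep the
-- list sorted.  (ii) In a sorted ordering, two vertices in different components have their
-- whole components comparable; this is impossible if a block strictly between B^min_ω and
-- B^max_ω meets another component, and, as B^min_(ω-1) ≤ V_ω, also if
-- B^min_ω < B^max_(ω-1) without V_ω ⊆ B^min_(ω-1).
module Submission where

open import Defs hiding (sym)
open import Data.Nat using (ℕ)
open import Data.Fin using (Fin) renaming (_≤_ to _≤ᶠ_)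
open import Data.List using (List)
open import Data.List.NonEmpty using (List⁺)
open import Data.Product using (∃; _×_)
open import Relation.Nullary using (¬_)

open import Data.Bool using (Bool; true; false)
open import Data.Empty using (⊥-elim)
open import Data.Fin using (_≟_; toℕ)
open import Data.List using ([]; _∷_; _++_; foldl; reverse)
open import Data.List.NonEmpty using (_∷_; toList; foldr₁)
import Data.List.NonEmpty as List⁺
open import Data.List.Membership.Propositional using (_∈_; _∉_; find)
open import Data.List.Membership.Propositional.Properties using (∈-++⁺ˡ; ∈-++⁺ʳ; ∈-++⁻)
open import Data.List.Properties using (++-conicalʳ)
open import Data.List.Relation.Binary.Lex.Core using (halt)
open import Data.List.Relation.Unary.All as All using (All; []; _∷_)
open import Data.List.Relation.Unary.AllPairs using (AllPairs; []; _∷_)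
open import Data.List.Relation.Unary.Any using (here; there)
open import Data.List.Relation.Unary.Linked using (Linked; []; [-]; _∷_)
import Data.List.Relation.Unary.Linked.Properties as Linked
open import Data.Nat using (_≤_; _<_; _⊓_; _⊔_)
open import Data.Nat.Properties
  using (≤-refl; ≤-trans; ≤-antisym; <-irrefl; ≮⇒≥; m⊓n≤m; m⊓n≤n; m≤m⊔n; m≤n⊔m; ⊓-sel; ⊔-sel; module ≤-Reasoning)
open import Data.Product using (_,_; proj₁; proj₂)
open import Data.Sum using (_⊎_; inj₁; inj₂)
import Data.Sum as Sum
open import Data.Unit using (⊤; tt)
open import Function using (_∘_; flip; case_of_)
open import Relation.Binary.PropositionalEquality
  using (_≡_; _≢_; refl; sym; trans; cong; subst; subst₂)
open import Relation.Nullary using (yes; no)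

module _ {A : Set} where

  Linked-reverse⁺ : ∀ {R : A → A → Set} {xs} → Linked (flip R) xs → Linked R (reverse xs)
  Linked-reverse⁺ [] = []
  Linked-reverse⁺ {R} {x ∷ xs} rs = go [-] rs
    where
    go : ∀ {y acc ys} → Linked R (y ∷ acc) → Linked (flip R) (y ∷ ys) →
         Linked R (foldl (flip _∷_) (y ∷ acc) ys)
    go done [-]        = done
    go done (r ∷ rest) = go (r ∷ done) rest

  Linked⇒AllPairs-through : ∀ {P : A → Set} {R : A → A → Set} →
    (∀ {x y z} → P y → R x y → R y z → R x z) →
    ∀ {xs} → All P xs → Linked R xs → AllPairs R xs
  Linked⇒AllPairs-through {P} {R} trans′ = pairs
    where
    heads : ∀ {v y ys} → All P (y ∷ ys) → R v y → Linked R (y ∷ ys) → All (R v) (y ∷ ys)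
    heads _              Rvy [-]          = Rvy ∷ []
    heads (Py ∷ Pys)     Rvy (Ryz ∷ rest) = Rvy ∷ heads Pys (trans′ Py Rvy Ryz) rest

    pairs : ∀ {xs} → All P xs → Linked R xs → AllPairs R xs
    pairs []         []         = []
    pairs _          [-]        = [] ∷ []
    pairs (_ ∷ Pxs)  (Rxy ∷ rs) = heads Pxs Rxy rs ∷ pairs Pxs rs

  AllPairs-related : ∀ {R : A → A → Set} {xs x y} → AllPairs R xs →
    x ∈ xs → y ∈ xs → x ≢ y → R x y ⊎ R y x
  AllPairs-related (_ ∷ _)   (here refl) (here refl) x≢y = ⊥-elim (x≢y refl)
  AllPairs-related (Rx ∷ _)  (here refl) (there y∈)  _   = inj₁ (All.lookup Rx y∈)
  AllPairs-related (Ry ∷ _)  (there x∈)  (here refl) _   = inj₂ (All.lookup Ry x∈)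
  AllPairs-related (_ ∷ rs)  (there x∈)  (there y∈)  x≢y = AllPairs-related rs x∈ y∈ x≢y

module _ {A : Set} (f : A → ℕ) where

  min-map-≤ : ∀ (C : List⁺ A) {x} → x ∈ toList C → foldr₁ _⊓_ (List⁺.map f C) ≤ f x
  min-map-≤ (c ∷ [])     (here refl) = ≤-refl
  min-map-≤ (c ∷ d ∷ ds) (here refl) = m⊓n≤m _ _
  min-map-≤ (c ∷ d ∷ ds) (there x∈)  = ≤-trans (m⊓n≤n _ _) (min-map-≤ (d ∷ ds) x∈)

  max-map-≥ : ∀ (C : List⁺ A) {x} → x ∈ toList C → f x ≤ foldr₁ _⊔_ (List⁺.map f C)
  max-map-≥ (c ∷ [])     (here refl) = ≤-refl
  max-map-≥ (c ∷ d ∷ ds) (here refl) = m≤m⊔n _ _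
  max-map-≥ (c ∷ d ∷ ds) (there x∈)  = ≤-trans (max-map-≥ (d ∷ ds) x∈) (m≤n⊔m _ _)

  min-map-attained : ∀ (C : List⁺ A) → ∃ λ a → a ∈ toList C × f a ≡ foldr₁ _⊓_ (List⁺.map f C)
  min-map-attained (c ∷ cs) = attained c cs
    where
    attained : ∀ c cs → ∃ λ a → a ∈ c ∷ cs × f a ≡ foldr₁ _⊓_ (List⁺.map f (c ∷ cs))
    attained c []       = c , here refl , refl
    attained c (d ∷ ds) with ⊓-sel (f c) (foldr₁ _⊓_ (List⁺.map f (d ∷ ds)))
    ... | inj₁ c-min  = c , here refl , sym c-min
    ... | inj₂ ds-min =
      let a , a∈ , fa = attained d ds in a , there a∈ , trans fa (sym ds-min)

  max-map-attained : ∀ (C : List⁺ A) → ∃ λ a → a ∈ toList C × f a ≡ foldr₁ _⊔_ (List⁺.map f C)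
  max-map-attained (c ∷ cs) = attained c cs
    where
    attained : ∀ c cs → ∃ λ a → a ∈ c ∷ cs × f a ≡ foldr₁ _⊔_ (List⁺.map f (c ∷ cs))
    attained c []       = c , here refl , refl
    attained c (d ∷ ds) with ⊔-sel (f c) (foldr₁ _⊔_ (List⁺.map f (d ∷ ds)))
    ... | inj₁ c-max  = c , here refl , sym c-max
    ... | inj₂ ds-max =
      let a , a∈ , fa = attained d ds in a , there a∈ , trans fa (sym ds-max)

adj-sym : ∀ {n} (G : Graph n) {x y} → Adj G x y ≡ true → Adj G y x ≡ true
adj-sym G {x} {y} xy = trans (Graph.sym G y x) xy

module _ {n} {G : Graph n} where

  reach-trans : ∀ {x y z} → Reach G x y → Reach G y z → Reach G x z
  reach-trans here          yz = yz
  reach-trans (step xw wy) yz = step xw (reach-trans wy yz)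

  reach-sym : ∀ {x y} → Reach G x y → Reach G y x
  reach-sym here          = here
  reach-sym (step xw wy) = reach-trans (reach-sym wy) (step (adj-sym G xw) here)

  reach-preserves : ∀ {P : Fin n → Set} → (∀ {x y} → P x → Adj G x y ≡ true → P y) →
    ∀ {x y} → P x → Reach G x y → P y
  reach-preserves adj-preserves Px here          = Px
  reach-preserves adj-preserves Px (step xw wy) = reach-preserves adj-preserves (adj-preserves Px xw) wy

Connected : ∀ {n} → Graph n → List (Fin n) → Set
Connected G W = ∀ x y → x ∈ W → y ∈ W → Reach G x y

connected-from : ∀ {n} {G : Graph n} {W r} → (∀ {x} → x ∈ W → Reach G r x) → Connected G W
connected-from from-r x y x∈ y∈ = reach-trans (reach-sym (from-r x∈)) (from-r y∈)

module _ {n} (ψ : WeakOrder n) where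

  ⊑-trans : ∀ {U W X} → (∃ λ w → w ∈ W) → U ⊑[ ψ ] W → W ⊑[ ψ ] X → U ⊑[ ψ ] X
  ⊑-trans (w , w∈) UW WX x y x∈ y∈ = ≤-trans (UW x w x∈ w∈) (WX w y w∈ y∈)

  ⊆Bmin⇒⊑ : ∀ {C L} → ⊆Bmin ψ C L → toList C ⊑[ ψ ] toList L
  ⊆Bmin⇒⊑ {C} {L} C⊆ x y x∈ y∈ = subst (_≤ rk ψ y) (sym (C⊆ x x∈)) (min-map-≤ (rk ψ) L y∈)

  ⊑-⊆Bmin : ∀ {K C L} → K ⊑[ ψ ] toList L → ⊆Bmin ψ C L → K ⊑[ ψ ] toList C
  ⊑-⊆Bmin {L = L} KL C⊆ x y x∈ y∈ =
    let m , m∈ , m-min = min-map-attained (rk ψ) L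
    in subst (rk ψ x ≤_) (trans m-min (sym (C⊆ y y∈))) (KL x m x∈ m∈)

  bmax≤bmin⇒⊑ : ∀ {L C} → bmax ψ L ≤ bmin ψ C → toList L ⊑[ ψ ] toList C
  bmax≤bmin⇒⊑ {L} {C} max≤min x y x∈ y∈ =
    ≤-trans (max-map-≥ (rk ψ) L x∈) (≤-trans max≤min (min-map-≤ (rk ψ) C y∈))

  ReverseSorted : List (List⁺ (Fin n)) → Set
  ReverseSorted = Linked (λ U W → toList W ⊑[ ψ ] toList U)

  swap-sorted : ∀ {L C R} → ⊆Bmin ψ C L → ReverseSorted (L ∷ R) → ReverseSorted (L ∷ C ∷ R)
  swap-sorted C⊆ [-]          = ⊆Bmin⇒⊑ C⊆ ∷ [-]
  swap-sorted C⊆ (K⊑L ∷ rest) = ⊆Bmin⇒⊑ C⊆ ∷ ⊑-⊆Bmin K⊑L C⊆ ∷ rest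

  reverseSorted⇒sorted : ∀ {D} → ReverseSorted D → SortedBy ψ (componentsList (reverse D))
  reverseSorted⇒sorted = Linked.map⁺ ∘ Linked-reverse⁺

module _ {n} (G : Graph n) (ψ : WeakOrder n) where

  Orderable : Set
  Orderable = ∃ λ Ws → IsComponentOrdering G Ws × SortedBy ψ Ws

  _≼_ : Fin n → Fin n → Set
  x ≼ z = ∀ {a b} → Reach G x a → Reach G z b → rk ψ a ≤ rk ψ b

  ⊑⇒≼ : ∀ {W W' x z} → IsComponent G W → IsComponent G W' → x ∈ W → z ∈ W' →
    W ⊑[ ψ ] W' → x ≼ z
  ⊑⇒≼ (_ , _ , W-closed) (_ , _ , W'-closed) x∈ z∈ WW' {a} {b} xa zb =
    WW' a b (W-closed _ a x∈ xa) (W'-closed _ b z∈ zb)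

  unreachable-comparable : Orderable → ∀ {x z} → ¬ Reach G x z → x ≼ z ⊎ z ≼ x
  unreachable-comparable (Ws , (comps , covers , _) , sorted) {x} {z} x↛z
    with find (covers x) | find (covers z)
  ... | W , W∈ , x∈W | W' , W'∈ , z∈W' =
    Sum.map (⊑⇒≼ W-comp W'-comp x∈W z∈W') (⊑⇒≼ W'-comp W-comp z∈W' x∈W)
      (AllPairs-related sorted-pairs W∈ W'∈ W≢W')
    where
    W-comp  = All.lookup comps W∈
    W'-comp = All.lookup comps W'∈
    sorted-pairs : AllPairs (λ U W → U ⊑[ ψ ] W) Ws
    sorted-pairs = Linked⇒AllPairs-through (⊑-trans ψ) (All.map proj₁ comps) sorted
    W≢W' : W ≢ W'
    W≢W' refl = x↛z (proj₁ (proj₂ W-comp) x z x∈W z∈W')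

  gap⇒¬orderable : ∀ {C} → IsComponent G (toList C) → GapFail ψ C → ¬ Orderable
  gap⇒¬orderable {C} (_ , C-connected , C-closed) (b , min<b , b<max , z , z∈b , z∉C) ord
    with min-map-attained (rk ψ) C | max-map-attained (rk ψ) C
  ... | a , a∈C , a-min | c , c∈C , c-max
    with unreachable-comparable ord (λ a→z → z∉C (C-closed a z a∈C a→z))
  ... | inj₁ a≼z = <-irrefl refl (begin-strict
    bmax ψ C          ≡⟨ sym c-max ⟩
    rk ψ c            ≤⟨ a≼z (C-connected a c a∈C c∈C) here ⟩
    rk ψ z            ≡⟨ cong toℕ z∈b ⟩
    toℕ b             <⟨ b<max ⟩
    bmax ψ C          ∎)
    where open ≤-Reasoning
  ... | inj₂ z≼a = <-irrefl refl (begin-strict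
    bmin ψ C          <⟨ min<b ⟩
    toℕ b             ≡⟨ cong toℕ z∈b ⟨
    rk ψ z            ≤⟨ z≼a here here ⟩
    rk ψ a            ≡⟨ a-min ⟩
    bmin ψ C          ∎)
    where open ≤-Reasoning

  clash⇒¬orderable : ∀ {L C} → IsComponent G (toList L) → IsComponent G (toList C) →
    Disjoint (toList L) (toList C) → (∀ {x} → x ∈ toList C → bmin ψ L ≤ rk ψ x) →
    ¬ ⊆Bmin ψ C L → bmin ψ C < bmax ψ L → ¬ Orderable
  clash⇒¬orderable {L} {C} (_ , L-connected , L-closed) (_ , C-connected , _)
    disjoint L≤C C⊈ min<max ord
    with max-map-attained (rk ψ) L | min-map-attained (rk ψ) L | min-map-attained (rk ψ) C
  ... | l , l∈L , l-max | m , m∈L , m-min | a , a∈C , a-min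
    with unreachable-comparable ord (λ l→a → disjoint a (L-closed l a l∈L l→a) a∈C)
  ... | inj₁ l≼a = <-irrefl refl (begin-strict
    bmax ψ L          ≡⟨ l-max ⟨
    rk ψ l            ≤⟨ l≼a here here ⟩
    rk ψ a            ≡⟨ a-min ⟩
    bmin ψ C          <⟨ min<max ⟩
    bmax ψ L          ∎)
    where open ≤-Reasoning
  ... | inj₂ a≼l = C⊈ λ x x∈C → ≤-antisym
    (subst (rk ψ x ≤_) m-min (a≼l (C-connected a x a∈C x∈C) (L-connected l m l∈L m∈L)))
    (L≤C x∈C)

module _ {n : ℕ} where

  Done : (Fin n → Bool) → List (Fin n) → Fin n → Set
  Done vis cs x = vis x ≡ true × x ∉ cs

  Pending : (Fin n → Bool) → List (Fin n) → Fin n → Set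
  Pending vis cs x = vis x ≡ false ⊎ x ∈ cs

  Quiet : (Fin n → Bool) → (Fin n → List ℕ) → Set
  Quiet vis lab = ∀ {y} → vis y ≡ false → lab y ≡ []

  visited≢unvisited : ∀ {vis : Fin n → Bool} {x} → vis x ≡ true → ¬ vis x ≡ false
  visited≢unvisited x-visited x-unvisited with trans (sym x-visited) x-unvisited
  ... | ()

  module _ (s : State n) (p : Fin n) where

    visitMark-self : visitMark s p p ≡ true
    visitMark-self with p ≟ p
    ... | yes _   = refl
    ... | no p≢p = ⊥-elim (p≢p refl)

    visitMark-visited : ∀ {x} → visited s x ≡ true → visitMark s p x ≡ true
    visitMark-visited {x} x-visited with x ≟ p
    ... | yes _ = refl
    ... | no _  = x-visited

    visitMark-true⁻ : ∀ {x} → visitMark s p x ≡ true → x ≡ p ⊎ visited s x ≡ true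
    visitMark-true⁻ {x} x-marked with x ≟ p
    ... | yes x≡p = inj₁ x≡p
    ... | no _    = inj₂ x-marked

    visitMark-false⁻ : ∀ {x} → visitMark s p x ≡ false → visited s x ≡ false × x ≢ p
    visitMark-false⁻ {x} x-unmarked with x ≟ p
    visitMark-false⁻ {x} () | yes _
    ... | no x≢p = x-unmarked , x≢p

  module _ (G : Graph n) (s : State n) (p : Fin n) where

    visitLabels-labelled : ∀ {y} → label s y ≢ [] → visitLabels G s p y ≢ []
    visitLabels-labelled {y} y-labelled with visited s y | Adj G p y
    ... | false | true  = (λ ()) ∘ ++-conicalʳ (label s y) _
    ... | false | false = y-labelled
    ... | true  | _     = y-labelled

    visitLabels-neighbour : ∀ {y} → visited s y ≡ false → Adj G p y ≡ true →
      visitLabels G s p y ≢ []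
    visitLabels-neighbour {y} y-unvisited py rewrite y-unvisited | py =
      (λ ()) ∘ ++-conicalʳ (label s y) _

    visitLabels-labelled⁻ : ∀ {y} → visitLabels G s p y ≢ [] → label s y ≢ [] ⊎ Adj G p y ≡ true
    visitLabels-labelled⁻ {y} y-labelled with visited s y | Adj G p y
    ... | false | true  = inj₂ refl
    ... | false | false = inj₁ y-labelled
    ... | true  | _     = inj₁ y-labelled

  -- A visit moves q from the unvisited vertices into the current component, so the
  -- vertices of completed components stay the same.
  module _ (s : State n) {q : Fin n} (q-unvisited : visited s q ≡ false) {cs : List (Fin n)} where

    visit-Done⁺ : ∀ {x} → Done (visited s) cs x → Done (visitMark s q) (cs ++ q ∷ []) x
    visit-Done⁺ {x} (x-visited , x∉cs) = visitMark-visited s q x-visited , x∉cs++q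
      where
      x∉cs++q : x ∉ cs ++ q ∷ []
      x∉cs++q x∈ with ∈-++⁻ cs x∈
      ... | inj₁ x∈cs        = x∉cs x∈cs
      ... | inj₂ (here refl) = visited≢unvisited {vis = visited s} x-visited q-unvisited

    visit-Done⁻ : ∀ {x} → Done (visitMark s q) (cs ++ q ∷ []) x → Done (visited s) cs x
    visit-Done⁻ {x} (x-marked , x∉) with visitMark-true⁻ s q {x} x-marked
    ... | inj₁ refl      = ⊥-elim (x∉ (∈-++⁺ʳ cs (here refl)))
    ... | inj₂ x-visited = x-visited , x∉ ∘ ∈-++⁺ˡ

    visit-Pending⁻ : ∀ {x} → Pending (visitMark s q) (cs ++ q ∷ []) x → Pending (visited s) cs x
    visit-Pending⁻ (inj₁ x-unmarked) = inj₁ (proj₁ (visitMark-false⁻ s q x-unmarked))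
    visit-Pending⁻ (inj₂ x∈) with ∈-++⁻ cs x∈
    ... | inj₁ x∈cs        = inj₂ x∈cs
    ... | inj₂ (here refl) = inj₁ q-unvisited

module _ {n} (G : Graph n) (ψ : WeakOrder n) where

  open import Data.List.Membership.DecPropositional (_≟_ {n}) using (_∈?_)

  HeadMinimal : (Fin n → Bool) → List (Fin n) → Set
  HeadMinimal vis []      = ⊤
  HeadMinimal vis (c ∷ _) = ∀ {y} → vis y ≡ false → rk ψ c ≤ rk ψ y

  PreviousComponent : (Fin n → Bool) → List (Fin n) → List⁺ (Fin n) → Set
  PreviousComponent vis cs L =
    (∀ {x} → x ∈ toList L → Done vis cs x) ×
    (∀ {x} → Pending vis cs x → bmin ψ L ≤ rk ψ x) ×
    IsComponent G (toList L)

  -- The completed components are stored in reverse, so the head is V_(ω-1).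
  PreviousOK : (Fin n → Bool) → List (Fin n) → List (List⁺ (Fin n)) → Set
  PreviousOK vis cs []      = ⊤
  PreviousOK vis cs (L ∷ _) = PreviousComponent vis cs L

  record Invariant (vis : Fin n → Bool) (lab : Fin n → List ℕ)
                   (cs : List (Fin n)) (D : List (List⁺ (Fin n))) : Set where
    field
      cur-visited       : ∀ {x} → x ∈ cs → vis x ≡ true
      done-closed       : ∀ {x y} → Done vis cs x → Adj G x y ≡ true → Done vis cs y
      frontier-labelled : ∀ {x y} → x ∈ cs → Adj G x y ≡ true → vis y ≡ false → lab y ≢ []
      cur-connected     : Connected G cs
      head-minimal      : HeadMinimal vis cs
      previous-ok       : PreviousOK vis cs D
      reverse-sorted    : ReverseSorted ψ D
  open Invariant

  -- Not part of Invariant: it fails initially, when the start vertex is labelled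
  -- although no component is open yet.
  Labelled⊆Frontier : (Fin n → Bool) → (Fin n → List ℕ) → List (Fin n) → Set
  Labelled⊆Frontier vis lab cs =
    ∀ {y} → vis y ≡ false → lab y ≢ [] → ∃ λ x → x ∈ cs × Adj G x y ≡ true

  headMinimal-mono : ∀ {vis vis′} → (∀ {y} → vis′ y ≡ false → vis y ≡ false) →
    ∀ cs → HeadMinimal vis cs → HeadMinimal vis′ cs
  headMinimal-mono _         []      _       = tt
  headMinimal-mono unvisited (_ ∷ _) minimal = minimal ∘ unvisited

  previousComponent-mono : ∀ {vis vis′ cs cs′ L} →
    (∀ {x} → Done vis cs x → Done vis′ cs′ x) → (∀ {x} → Pending vis′ cs′ x → Pending vis cs x) →
    PreviousComponent vis cs L → PreviousComponent vis′ cs′ L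
  previousComponent-mono done pending (L-done , L-min , L-comp) =
    (λ x∈ → done (L-done x∈)) , (λ x-pending → L-min (pending x-pending)) , L-comp

  previousOK-mono : ∀ {vis vis′ cs cs′} →
    (∀ {x} → Done vis cs x → Done vis′ cs′ x) → (∀ {x} → Pending vis′ cs′ x → Pending vis cs x) →
    ∀ D → PreviousOK vis cs D → PreviousOK vis′ cs′ D
  previousOK-mono _    _       []      _        = tt
  previousOK-mono done pending (_ ∷ _) previous = previousComponent-mono done pending previous

  visit-invariant : ∀ (s : State n) {q cs D} → Invariant (visited s) (label s) cs D →
    visited s q ≡ false → (∀ {x} → x ∈ cs → Reach G q x) →
    HeadMinimal (visited s) (cs ++ q ∷ []) →
    Invariant (visitMark s q) (visitLabels G s q) (cs ++ q ∷ []) D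
  visit-invariant s {q} {cs} {D} I q-unvisited q-reaches cs-q-minimal = record
    { cur-visited       = cur-visited′
    ; done-closed       = λ x-done xy →
        visit-Done⁺ s q-unvisited (done-closed I (visit-Done⁻ s q-unvisited x-done) xy)
    ; frontier-labelled = frontier-labelled′
    ; cur-connected     = connected-from reaches′
    ; head-minimal      =
        headMinimal-mono (λ {y} → proj₁ ∘ visitMark-false⁻ s q {y}) (cs ++ q ∷ []) cs-q-minimal
    ; previous-ok       =
        previousOK-mono (visit-Done⁺ s q-unvisited) (visit-Pending⁻ s q-unvisited) D (previous-ok I)
    ; reverse-sorted    = reverse-sorted I
    }
    where
    cur-visited′ : ∀ {x} → x ∈ cs ++ q ∷ [] → visitMark s q x ≡ true
    cur-visited′ x∈ with ∈-++⁻ cs x∈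
    ... | inj₁ x∈cs        = visitMark-visited s q (cur-visited I x∈cs)
    ... | inj₂ (here refl) = visitMark-self s q

    frontier-labelled′ : ∀ {x y} → x ∈ cs ++ q ∷ [] → Adj G x y ≡ true →
      visitMark s q y ≡ false → visitLabels G s q y ≢ []
    frontier-labelled′ {y = y} x∈ xy y-unmarked with ∈-++⁻ cs x∈ | visitMark-false⁻ s q {y} y-unmarked
    ... | inj₁ x∈cs        | y-unvisited , _ =
      visitLabels-labelled G s q (frontier-labelled I x∈cs xy y-unvisited)
    ... | inj₂ (here refl) | y-unvisited , _ = visitLabels-neighbour G s q y-unvisited xy

    reaches′ : ∀ {x} → x ∈ cs ++ q ∷ [] → Reach G q x
    reaches′ x∈ with ∈-++⁻ cs x∈
    ... | inj₁ x∈cs        = q-reaches x∈cs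
    ... | inj₂ (here refl) = here

  visit-frontier : ∀ (s : State n) {q cs} →
    (∀ {y} → visited s y ≡ false → label s y ≢ [] → y ≢ q → ∃ λ x → x ∈ cs × Adj G x y ≡ true) →
    Labelled⊆Frontier (visitMark s q) (visitLabels G s q) (cs ++ q ∷ [])
  visit-frontier s {q} {cs} frontier {y} y-unmarked y-labelled′
    with visitMark-false⁻ s q {y} y-unmarked | visitLabels-labelled⁻ G s q {y} y-labelled′
  ... | y-unvisited , y≢q | inj₁ y-labelled =
    let x , x∈ , xy = frontier y-unvisited y-labelled y≢q in x , ∈-++⁺ˡ x∈ , xy
  ... | _ | inj₂ qy = q , ∈-++⁺ʳ cs (here refl) , qy

  open-visit : ∀ (s : State n) {q D} → Invariant (visited s) (label s) [] D →
    visited s q ≡ false → (∀ {y} → visited s y ≡ false → rk ψ q ≤ rk ψ y) →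
    (∀ {y} → visited s y ≡ false → label s y ≢ [] → y ≡ q) →
    Invariant (visitMark s q) (visitLabels G s q) (q ∷ []) D ×
    Labelled⊆Frontier (visitMark s q) (visitLabels G s q) (q ∷ [])
  open-visit s I q-unvisited q-minimal only-q-labelled =
    visit-invariant s I q-unvisited (λ ()) q-minimal ,
    visit-frontier s {cs = []} λ y-unvisited y-labelled y≢q →
      ⊥-elim (y≢q (only-q-labelled y-unvisited y-labelled))

  join-visit : ∀ (s : State n) {q c cs D} → Invariant (visited s) (label s) (c ∷ cs) D →
    Labelled⊆Frontier (visited s) (label s) (c ∷ cs) → visited s q ≡ false → label s q ≢ [] →
    Invariant (visitMark s q) (visitLabels G s q) (c ∷ cs ++ q ∷ []) D ×
    Labelled⊆Frontier (visitMark s q) (visitLabels G s q) (c ∷ cs ++ q ∷ [])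
  join-visit s {q} {c} {cs} I frontier q-unvisited q-labelled =
    visit-invariant s I q-unvisited q-reaches (head-minimal I) ,
    visit-frontier s λ y-unvisited y-labelled _ → frontier y-unvisited y-labelled
    where
    q-reaches : ∀ {x} → x ∈ c ∷ cs → Reach G q x
    q-reaches x∈ =
      let w , w∈ , wq = frontier q-unvisited q-labelled
      in step (adj-sym G wq) (cur-connected I w _ w∈ x∈)

  module _ {vis lab cs D} (I : Invariant vis lab cs D) (quiet : Quiet vis lab) where

    cur-closed : ∀ {x y} → x ∈ cs → Adj G x y ≡ true → y ∈ cs
    cur-closed {y = y} x∈ xy with vis y in y-visited
    ... | false = ⊥-elim (frontier-labelled I x∈ xy y-visited (quiet y-visited))
    ... | true with y ∈? cs
    ...   | yes y∈ = y∈
    ...   | no y∉  = ⊥-elim (proj₂ (done-closed I (y-visited , y∉) (adj-sym G xy)) x∈)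

    visited-closed : ∀ {x y} → vis x ≡ true → Adj G x y ≡ true → vis y ≡ true
    visited-closed {x} x-visited xy with x ∈? cs
    ... | yes x∈ = cur-visited I (cur-closed x∈ xy)
    ... | no x∉  = proj₁ (done-closed I (x-visited , x∉) xy)

  module _ {vis lab} {C : List⁺ (Fin n)} {D} (I : Invariant vis lab (toList C) D)
           (quiet : Quiet vis lab) where

    completed-component : IsComponent G (toList C)
    completed-component =
      (_ , here refl) , cur-connected I ,
      λ x y x∈ xy → reach-preserves {P = _∈ toList C} (cur-closed I quiet) x∈ xy

    completed-previous : PreviousComponent vis [] C
    completed-previous = (λ x∈ → cur-visited I x∈ , λ ()) , lower-bound , completed-component
      where
      lower-bound : ∀ {x} → Pending vis [] x → bmin ψ C ≤ rk ψ x
      lower-bound (inj₁ x-unvisited) =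
        ≤-trans (min-map-≤ (rk ψ) C (here refl)) (head-minimal I x-unvisited)

    completion-ordered : ∀ {D′} → Complete ψ D C (ok D′) → PreviousOK vis [] D′ × ReverseSorted ψ D′
    completion-ordered (first _)             = completed-previous , [-]
    completion-ordered (swap _ C⊆)           =
      previousComponent-mono (λ (x-visited , _) → x-visited , λ ())
        (λ { (inj₁ x-unvisited) → inj₁ x-unvisited ; (inj₂ ()) }) (previous-ok I) ,
      swap-sorted ψ C⊆ (reverse-sorted I)
    completion-ordered (append _ _ ¬min<max) =
      completed-previous , bmax≤bmin⇒⊑ ψ (≮⇒≥ ¬min<max) ∷ reverse-sorted I

    complete-ok : ∀ {D′} → Complete ψ D C (ok D′) → Invariant vis lab [] D′
    complete-ok completed = record
      { cur-visited       = λ ()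
      ; done-closed       = λ (x-visited , _) xy → visited-closed I quiet x-visited xy , λ ()
      ; frontier-labelled = λ ()
      ; cur-connected     = λ _ _ ()
      ; head-minimal      = tt
      ; previous-ok       = proj₁ (completion-ordered completed)
      ; reverse-sorted    = proj₂ (completion-ordered completed)
      }

    complete-fail : Complete ψ D C fail → ¬ Orderable G ψ
    complete-fail (gap gap-in-C) = gap⇒¬orderable G ψ completed-component gap-in-C
    complete-fail (clash _ C⊈ min<max) with previous-ok I
    ... | L-done , L-min , L-component =
      clash⇒¬orderable G ψ L-component completed-component
        (λ _ x∈L → proj₂ (L-done x∈L)) (λ x∈C → L-min (inj₂ x∈C)) C⊈ min<max

  all-visited⇒quiet : ∀ {vis : Fin n → Bool} {lab} → (∀ x → vis x ≡ true) → Quiet vis lab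
  all-visited⇒quiet {vis} all-visited {y} = ⊥-elim ∘ visited≢unvisited {vis = vis} (all-visited y)

  empty-pick⇒quiet : ∀ {s p} → Pickable ψ s p → label s p ≡ [] → Quiet (visited s) (label s)
  empty-pick⇒quiet {s} (_ , p-max , _) p-empty {y} y-unvisited with label s y in y-label
  ... | []    = refl
  ... | _ ∷ _ = ⊥-elim (p-max y y-unvisited (subst₂ _<lex_ (sym p-empty) (sym y-label) halt))

  frontier-[]⇒quiet : ∀ {vis lab} → Labelled⊆Frontier vis lab [] → Quiet vis lab
  frontier-[]⇒quiet {lab = lab} frontier {y} y-unvisited with lab y in y-label
  ... | []    = refl
  ... | _ ∷ _ with frontier y-unvisited (λ y-empty → case trans (sym y-label) y-empty of λ ())
  ...   | _ , () , _

  quiet-open-visit : ∀ (s : State n) {p D} → Invariant (visited s) (label s) [] D →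
    Quiet (visited s) (label s) → Pickable ψ s p →
    Invariant (visitMark s p) (visitLabels G s p) (p ∷ []) D ×
    Labelled⊆Frontier (visitMark s p) (visitLabels G s p) (p ∷ [])
  quiet-open-visit s I quiet (p-unvisited , _ , p-first) =
    open-visit s I p-unvisited
      (λ y-unvisited → p-first _ y-unvisited (trans (quiet y-unvisited) (sym (quiet p-unvisited))))
      (λ y-unvisited y-labelled → ⊥-elim (y-labelled (quiet y-unvisited)))

  Correct : Outcome n → Set
  Correct (success Vs) = SortedBy ψ (componentsList Vs)
  Correct failure      = ¬ Orderable G ψ

  StateInvariant : State n → Set
  StateInvariant s = Invariant (visited s) (label s) (cur s) (rdone s) ×
                     Labelled⊆Frontier (visited s) (label s) (cur s)

  run-correct : ∀ {s o} → StateInvariant s → Run G ψ s o → Correct o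
  run-correct {s} (I , _) (finishOk all-visited refl completed) =
    reverseSorted⇒sorted ψ (reverse-sorted (complete-ok I quiet completed))
    where quiet = all-visited⇒quiet {lab = label s} all-visited
  run-correct {s} (I , _) (finishFail all-visited refl failed) =
    complete-fail I (all-visited⇒quiet {lab = label s} all-visited) failed
  run-correct {s} (I , frontier) (start pick refl next) =
    run-correct (quiet-open-visit s I (frontier-[]⇒quiet frontier) pick) next
  run-correct {s} (I , frontier) (join {p = p} pick refl p-label next) =
    run-correct (join-visit s I frontier (proj₁ pick) p-labelled) next
    where
    p-labelled : label s p ≢ []
    p-labelled p-empty = case trans (sym p-label) p-empty of λ ()
  run-correct {s} (I , _) (openFail pick refl p-empty failed) =
    complete-fail I (empty-pick⇒quiet {s} pick p-empty) failed
  run-correct {s} (I , _) (openOk pick refl p-empty completed next) =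
    run-correct (quiet-open-visit s (complete-ok I quiet completed) quiet pick) next
    where quiet = empty-pick⇒quiet {s} pick p-empty

  module _ (u : Fin n) where

    initial-label-start : label (initState u) u ≡ n ∷ []
    initial-label-start with u ≟ u
    ... | yes _   = refl
    ... | no u≢u = ⊥-elim (u≢u refl)

    initial-labelled⇒start : ∀ {y} → label (initState u) y ≢ [] → y ≡ u
    initial-labelled⇒start {y} y-labelled with y ≟ u
    ... | yes y≡u = y≡u
    ... | no _    = ⊥-elim (y-labelled refl)

    initial-pick : ∀ {p} → Pickable ψ (initState u) p → p ≡ u
    initial-pick {p} (_ , p-max , _) with p ≟ u
    ... | yes p≡u = p≡u
    ... | no _    = ⊥-elim (p-max u refl
      (subst ([] <lex_) (sym initial-label-start) halt))

    initial-invariant : Invariant (visited (initState u)) (label (initState u)) [] []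
    initial-invariant = record
      { cur-visited       = λ ()
      ; done-closed       = λ ()
      ; frontier-labelled = λ ()
      ; cur-connected     = λ _ _ ()
      ; head-minimal      = tt
      ; previous-ok       = tt
      ; reverse-sorted    = []
      }

    run-from-initial : (∀ v → block ψ u ≤ᶠ block ψ v) → ∀ {o} → Run G ψ (initState u) o → Correct o
    run-from-initial _ (finishOk all-visited _ _)   = case all-visited u of λ ()
    run-from-initial _ (finishFail all-visited _ _) = case all-visited u of λ ()
    run-from-initial _ (join _ () _ _)
    run-from-initial _ (openFail _ () _ _)
    run-from-initial _ (openOk _ () _ _ _)
    run-from-initial u-first (start pick _ next) with initial-pick pick
    ... | refl = run-correct
      (open-visit (initState u) initial-invariant refl (λ {y} _ → u-first y) (λ _ → initial-labelled⇒start))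
      next

lemma4p2 : ∀ {n} (G : Graph n) (ψ : WeakOrder n) (u : Fin n) →
    (∀ v → block ψ u ≤ᶠ block ψ v) →
    ((Vs : List (List⁺ (Fin n))) → Run G ψ (initState u) (success Vs) →
       SortedBy ψ (componentsList Vs))
    ×
    (Run G ψ (initState u) failure →
       ¬ (∃ λ Ws → IsComponentOrdering G Ws × SortedBy ψ Ws))
lemma4p2 G ψ u u-first = (λ _ → run-from-initial G ψ u u-first) , run-from-initial G ψ u u-first
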